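{- Let $d\ge2$ be an integer, $\mathbf{u}=(u_1,\dots,u_{d-1})\in\mathbb{Z}^{d-1}$, $P(z)=1+u_1z+\dots+u_{d-1}z^{d-1}$ with $P(1)=1$, assume $f(z)=\prod_{t\ge0}P(z^{ -d^t})$ is badly approximable as a Laurent series, and write $g_{\mathbf{u}}(z)=z^{ -1}f(z)=\sum_{n=1}^\infty c_nz^{ -n}$. Then for every $n\ge1$, $$|c_n|\le\|\mathbf{u}\|_\infty^{\lceil\log_d n\rceil}\le\|\mathbf{u}\|_\infty^{\log_d n+1},$$ and consequently $\|\mathbf{c}_n\|_\infty\le\|\mathbf{u}\|_\infty^{\log_d n+1}$, where $\mathbf{c}_n=(c_1,\dots,c_n)$.
   Context: $\|\mathbf{u}\|_\infty=\max_i|u_i|$, $\|\mathbf{c}_n\|_\infty=\max_{i\le n}|c_i|$. Badly approximable: the partial quotients of the continued fraction of $f$ in $\mathbb{Q}((z^{ -1}))$ have bounded degree. -}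

module Defs where

open import Data.Nat as ℕ using (ℕ; zero; suc; _≤_; _<_; _⊔_; _^_; _∸_; _≤?_; _<?_)
open import Data.Integer as ℤ using (ℤ; +_; -[1+_]; ∣_∣)
open import Data.Rational as ℚ using (ℚ; 0ℚ; 1ℚ)
open import Data.Fin using (Fin; fromℕ<)
open import Data.Product using (Σ; _×_; ∃-syntax)
open import Relation.Nullary using (yes; no)
open import Relation.Binary.PropositionalEquality using (_≡_)

sumℤ : ℕ → (ℕ → ℤ) → ℤ
sumℤ zero    h = + 0
sumℤ (suc n) h = sumℤ n h ℤ.+ h n

sumℚ : ℕ → (ℕ → ℚ) → ℚ
sumℚ zero    h = 0ℚ
sumℚ (suc n) h = sumℚ n h ℚ.+ h n

sumFin : (k : ℕ) → (Fin k → ℤ) → ℤ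
sumFin zero    u = + 0
sumFin (suc k) u = u Fin.zero ℤ.+ sumFin k (λ i → u (Fin.suc i))
  where import Data.Fin as Fin

supNorm : (k : ℕ) → (Fin k → ℤ) → ℕ
supNorm zero    u = 0
supNorm (suc k) u = ∣ u Fin.zero ∣ ⊔ supNorm k (λ i → u (Fin.suc i))
  where import Data.Fin as Fin

-- The polynomial P(x) = 1 + u_1 x + … + u_{d-1} x^{d-1};
-- u_j (1 ≤ j ≤ d-1) is  u (j-1)  with  u : Fin (d ∸ 1) → ℤ.

coefP : (d : ℕ) → (Fin (d ∸ 1) → ℤ) → ℕ → ℤ
coefP d u zero = + 1
coefP d u (suc j) with j <? d ∸ 1
... | yes j<  = u (fromℕ< j<)
... | no  _   = + 0

PAtOne : (d : ℕ) → (Fin (d ∸ 1) → ℤ) → Set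
PAtOne d u = + 1 ℤ.+ sumFin (d ∸ 1) u ≡ + 1

-- Formal power series in x = z⁻¹ with integer coefficients (ℕ → ℤ)

cauchy : (ℕ → ℤ) → (ℕ → ℤ) → (ℕ → ℤ)
cauchy a b m = sumℤ (suc m) (λ i → a i ℤ.* b (m ∸ i))

unitSeries : ℕ → ℤ
unitSeries zero    = + 1
unitSeries (suc _) = + 0

-- coefficients of P(x^{d^t}):  coefficient of x^m is Σ_{j<d} [m = j·d^t] coefP j
factor : (d : ℕ) → (Fin (d ∸ 1) → ℤ) → ℕ → (ℕ → ℤ)
factor d u t m = sumℤ d (λ j → sel j (m ℕ.≟ j ℕ.* (d ^ t)))
  where
  open import Relation.Nullary using (Dec)
  sel : ℕ → {A : Set} → Dec A → ℤ
  sel j (yes _) = coefP d u j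
  sel j (no _)  = + 0

partialProd : (d : ℕ) → (Fin (d ∸ 1) → ℤ) → ℕ → (ℕ → ℤ)
partialProd d u zero    = unitSeries
partialProd d u (suc T) = cauchy (partialProd d u T) (factor d u T)

-- coefficient of z^{-m} in f(z) = ∏_{t≥0} P(z^{-d^t}).
-- For d ≥ 2 the factors with t > m are ≡ 1 mod z^{-(m+1)}, so the
-- coefficient is that of the partial product over t ≤ m.
fCoeff : (d : ℕ) → (Fin (d ∸ 1) → ℤ) → ℕ → ℤ
fCoeff d u m = partialProd d u (suc m) m

-- g_u(z) = z⁻¹ f(z) = Σ_{n≥1} c_n z^{-n};  c n is c_n for n ≥ 1 (c 0 = 0 unused)
c : (d : ℕ) → (Fin (d ∸ 1) → ℤ) → ℕ → ℤ
c d u zero    = + 0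
c d u (suc m) = fCoeff d u m

cNorm : (d : ℕ) → (Fin (d ∸ 1) → ℤ) → ℕ → ℕ
cNorm d u zero    = 0
cNorm d u (suc n) = cNorm d u n ⊔ ∣ c d u (suc n) ∣

-- Laurent series in z⁻¹ over ℚ:  Σ_{m ≥ 0} co m · z^{top - m}

record Laurent : Set where
  constructor laurent
  field
    top : ℕ
    co  : ℕ → ℚ
open Laurent public

coeff : Laurent → ℤ → ℚ
coeff L (+ k) with k ≤? top L
... | yes _ = co L (top L ∸ k)
... | no  _ = 0ℚ
coeff L -[1+ k ] = co L (top L ℕ.+ suc k)

-- build from a coefficient function that vanishes above exponent T
fromCoeff : ℕ → (ℤ → ℚ) → Laurent
fromCoeff T h = laurent T (λ m → h (+ T ℤ.- + m))

_≈L_ : Laurent → Laurent → Set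
A ≈L B = ∀ k → coeff A k ≡ coeff B k

_-L_ : Laurent → Laurent → Laurent
A -L B = fromCoeff (top A ⊔ top B) (λ k → coeff A k ℚ.- coeff B k)

_*L_ : Laurent → Laurent → Laurent
A *L B = laurent (top A ℕ.+ top B)
                 (λ m → sumℚ (suc m) (λ i → co A i ℚ.* co B (m ∸ i)))

oneL : Laurent
oneL = laurent 0 (λ { zero → 1ℚ ; (suc _) → 0ℚ })

fL : (d : ℕ) → (Fin (d ∸ 1) → ℤ) → Laurent
fL d u = laurent 0 (λ m → fCoeff d u m ℚ./ 1)

IsPoly : Laurent → Set
IsPoly a = ∀ k → coeff a -[1+ k ] ≡ 0ℚ

IsFrac : Laurent → Set
IsFrac A = ∀ k → coeff A (+ k) ≡ 0ℚ

-- (a , F) is the (infinite) continued fraction expansion of f: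
-- F 0 = f, a n = polynomial part of F n, F (n+1) = 1 / (F n - a n).
IsCF : Laurent → (ℕ → Laurent) → (ℕ → Laurent) → Set
IsCF f a F =
  (F 0 ≈L f) ×
  (∀ n → IsPoly (a n)) ×
  (∀ n → IsFrac (F n -L a n)) ×
  (∀ n → (F (suc n) *L (F n -L a n)) ≈L oneL)

-- badly approximable: (irrational, and) the partial quotients have bounded degree
BadlyApproximable : Laurent → Set
BadlyApproximable f =
  Σ (ℕ → Laurent) λ a → Σ (ℕ → Laurent) λ F →
    IsCF f a F × (∃[ B ] ∀ n k → B < k → coeff (a n) (+ k) ≡ 0ℚ)

-- ⌈log_d n⌉ for d ≥ 2, n ≥ 1: least k with n ≤ d^k (search with fuel n)

ceilLog : ℕ → ℕ → ℕ
ceilLog d n = go n 0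
  where
  go : ℕ → ℕ → ℕ
  go zero    k = k
  go (suc f) k with n ≤? d ^ k
  ... | yes _ = k
  ... | no  _ = go f (suc k)

-- LeRPow a b d n  means  a ≤ b^{log_d n + 1}  (real exponent), encoded as:
-- for all rationals p/q > log_d n (i.e. n^q < d^p), a^q ≤ b^{p+q}.
LeRPow : ℕ → ℕ → ℕ → ℕ → Set
LeRPow a b d n = ∀ p q → 1 ≤ q → n ^ q < d ^ p → a ^ q ≤ b ^ (p ℕ.+ q)

-- Writing m = i + j d^T with i < d^T, the factor P(x^(d^T)) meets the product of the earlier
-- factors only through its coefficient u_j, so the coefficient of x^m in ∏_t P(x^(d^t)) is the
-- product of the coefficients of P indexed by the base-d digits of m. Below d^k there are at
-- most k digits, and each nonzero one costs a factor of at most ‖u‖, giving |c_n| ≤ ‖u‖^⌈log_d n⌉.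
-- Bad approximability only rules out u = 0, where f = 1 is a polynomial.
module Submission where

open import Defs
open import Data.Nat
open import Data.Nat.Properties
open import Data.Nat.DivMod
open import Data.Integer as ℤ using (ℤ; +_; -[1+_]; ∣_∣)
import Data.Integer.Properties as ℤ
open import Data.Fin as Fin using (Fin; fromℕ<)
open import Data.Rational as ℚ using (0ℚ)
import Data.Rational.Properties as ℚ
open import Data.Product using (Σ; _×_; _,_; proj₁; proj₂)
open import Data.Sum using (inj₁; inj₂)
open import Data.Empty using (⊥-elim)
open import Relation.Nullary using (Dec; yes; no; ¬_)
open import Relation.Binary.PropositionalEquality
open import Function using (_∘_)

sumℤ-zero : ∀ n h → (∀ j → j < n → h j ≡ + 0) → sumℤ n h ≡ + 0
sumℤ-zero zero    h h≡0 = refl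
sumℤ-zero (suc n) h h≡0
  rewrite sumℤ-zero n h (λ j j<n → h≡0 j (m<n⇒m<1+n j<n)) | h≡0 n ≤-refl = refl

sumℤ-single : ∀ n h {i} → i < n → (∀ j → j < n → j ≢ i → h j ≡ + 0) → sumℤ n h ≡ h i
sumℤ-single (suc n) h {i} i<1+n h≡0 with m<1+n⇒m<n∨m≡n i<1+n
... | inj₁ i<n rewrite sumℤ-single n h i<n (λ j j<n → h≡0 j (m<n⇒m<1+n j<n))
                     | h≡0 n ≤-refl (λ n≡i → <-irrefl (sym n≡i) i<n) = ℤ.+-identityʳ (h i)
... | inj₂ refl rewrite sumℤ-zero n h (λ j j<n → h≡0 j (m<n⇒m<1+n j<n) (<⇒≢ j<n))
  = ℤ.+-identityˡ (h n)

-- The summand of factor is a local function of Defs; unifying against factor names it.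
factorSummand : (d : ℕ) → (Fin (d ∸ 1) → ℤ) → ℕ → ℕ → ℕ → ℤ
factorSummand d u t m = proj₁ summand
  where
  summand : Σ (ℕ → ℤ) λ h → factor d u t m ≡ sumℤ d h
  summand = _ , refl

factorSummand-≡ : ∀ d u t m j → m ≡ j * d ^ t → factorSummand d u t m j ≡ coefP d u j
factorSummand-≡ d u t m j m≡jN with m ≟ j * d ^ t
... | yes _    = refl
... | no  m≢jN = ⊥-elim (m≢jN m≡jN)

factorSummand-≢ : ∀ d u t m j → m ≢ j * d ^ t → factorSummand d u t m j ≡ + 0
factorSummand-≢ d u t m j m≢jN with m ≟ j * d ^ t
... | yes m≡jN = ⊥-elim (m≢jN m≡jN)
... | no  _    = refl

supNorm-≥ : ∀ n (v : Fin n → ℤ) i → ∣ v i ∣ ≤ supNorm n v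
supNorm-≥ (suc n) v Fin.zero    = m≤m⊔n _ _
supNorm-≥ (suc n) v (Fin.suc i) = ≤-trans (supNorm-≥ n (λ i → v (Fin.suc i)) i) (m≤n⊔m _ _)

^-cancelˡ-< : ∀ m .{{_ : NonZero m}} {n o} → m ^ n < m ^ o → n < o
^-cancelˡ-< m {n} {o} mⁿ<mᵒ with <-≤-connex n o
... | inj₁ n<o = n<o
... | inj₂ o≤n = ⊥-elim (<⇒≱ mⁿ<mᵒ (^-monoʳ-≤ m o≤n))

^-monoʳ-≤′ : ∀ m {n o} → 1 ≤ n → n ≤ o → m ^ n ≤ m ^ o
^-monoʳ-≤′ zero    {suc n} {suc o} _ _   = z≤n
^-monoʳ-≤′ (suc m)                 _ n≤o = ^-monoʳ-≤ (suc m) n≤o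

n<m^n : ∀ m → 1 < m → ∀ n → n < m ^ n
n<m^n m 1<m zero    = s≤s z≤n
n<m^n m 1<m (suc n) = ≤-<-trans (n<m^n m 1<m n) (^-monoʳ-< m 1<m (n<1+n n))

module PartialProducts (d-1 : ℕ) (u : Fin d-1 → ℤ) where

  d : ℕ
  d = suc d-1

  b : ℕ
  b = supNorm d-1 u

  coefP-≥ : ∀ {j} → d ≤ j → coefP d u j ≡ + 0
  coefP-≥ {suc j} (s≤s d-1≤j) with j <? d-1
  ... | yes j<d-1 = ⊥-elim (<⇒≱ j<d-1 d-1≤j)
  ... | no  _     = refl

  ∣coefP∣≤supNorm : ∀ j → ∣ coefP d u (suc j) ∣ ≤ b
  ∣coefP∣≤supNorm j with j <? d-1
  ... | yes j<d-1 = supNorm-≥ d-1 u (fromℕ< j<d-1)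
  ... | no  _     = z≤n

  factor-multiple : ∀ t j → factor d u t (j * d ^ t) ≡ coefP d u j
  factor-multiple t j with j <? d
  ... | yes j<d = trans (sumℤ-single d (factorSummand d u t (j * d ^ t)) j<d
                          (λ i _ i≢j → factorSummand-≢ d u t _ i (i≢j ∘ sym ∘ *-cancelʳ-≡ j i (d ^ t))))
                        (factorSummand-≡ d u t _ j refl)
    where instance _ = m^n≢0 d t
  ... | no  j≮d = trans (sumℤ-zero d (factorSummand d u t (j * d ^ t))
                          (λ i i<d → factorSummand-≢ d u t _ i λ jN≡iN →
                             j≮d (subst (_< d) (sym (*-cancelʳ-≡ j i (d ^ t) jN≡iN)) i<d)))
                        (sym (coefP-≥ (≮⇒≥ j≮d)))
    where instance _ = m^n≢0 d t

  factor-nonMultiple : ∀ t m → (∀ j → m ≢ j * d ^ t) → factor d u t m ≡ + 0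
  factor-nonMultiple t m m≢jN =
    sumℤ-zero d (factorSummand d u t m) (λ j _ → factorSummand-≢ d u t m j (m≢jN j))

  pp : ℕ → ℕ → ℤ
  pp = partialProd d u

  data Split (T : ℕ) : ℕ → Set where
    split : ∀ i j → i < d ^ T → Split T (i + j * d ^ T)

  splitAt : ∀ T x → Split T x
  splitAt T x = subst (Split T) (sym (m≡m%n+[m/n]*n x (d ^ T))) (split _ (x / d ^ T) (m%n<n x (d ^ T)))
    where instance _ = m^n≢0 d T

  remainder-unique : ∀ T {i i′} j j′ → i < d ^ T → i′ < d ^ T →
               i + j * d ^ T ≡ i′ + j′ * d ^ T → i ≡ i′
  remainder-unique T {i} {i′} j j′ i<N i′<N eq = begin
    i                          ≡⟨ m<n⇒m%n≡m i<N ⟨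
    i % d ^ T                  ≡⟨ [m+kn]%n≡m%n i j (d ^ T) ⟨
    (i + j * d ^ T) % d ^ T    ≡⟨ cong (_% d ^ T) eq ⟩
    (i′ + j′ * d ^ T) % d ^ T  ≡⟨ [m+kn]%n≡m%n i′ j′ (d ^ T) ⟩
    i′ % d ^ T                 ≡⟨ m<n⇒m%n≡m i′<N ⟩
    i′                         ∎
    where
    open ≡-Reasoning
    instance _ = m^n≢0 d T

  -- Only the summand i survives: any other i′ < d ^ T leaves x ∸ i′ off the multiples of d ^ T.
  partialProd-step : ∀ T → (∀ y → d ^ T ≤ y → pp T y ≡ + 0) →
                     ∀ {i} j → i < d ^ T → pp (suc T) (i + j * d ^ T) ≡ pp T i ℤ.* coefP d u j
  partialProd-step T ppT≡0 {i} j i<N = begin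
    sumℤ (suc x) (λ i′ → pp T i′ ℤ.* factor d u T (x ∸ i′))
      ≡⟨ sumℤ-single (suc x) _ (s≤s (m≤m+n i (j * N))) other≡0 ⟩
    pp T i ℤ.* factor d u T (x ∸ i)
      ≡⟨ cong (λ m → pp T i ℤ.* factor d u T m) (m+n∸m≡n i (j * N)) ⟩
    pp T i ℤ.* factor d u T (j * N)
      ≡⟨ cong (pp T i ℤ.*_) (factor-multiple T j) ⟩
    pp T i ℤ.* coefP d u j ∎
    where
    open ≡-Reasoning
    N x : ℕ
    N = d ^ T
    x = i + j * N
    other≡0 : ∀ i′ → i′ < suc x → i′ ≢ i → pp T i′ ℤ.* factor d u T (x ∸ i′) ≡ + 0
    other≡0 i′ i′≤x i′≢i with <-≤-connex i′ N
    ... | inj₂ N≤i′ = cong (ℤ._* factor d u T (x ∸ i′)) (ppT≡0 i′ N≤i′)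
    ... | inj₁ i′<N =
      trans (cong (pp T i′ ℤ.*_) (factor-nonMultiple T (x ∸ i′) off)) (ℤ.*-zeroʳ (pp T i′))
      where
      off : ∀ j′ → x ∸ i′ ≢ j′ * N
      off j′ x∸i′≡j′N = i′≢i (remainder-unique T j′ j i′<N i<N (begin
        i′ + j′ * N       ≡⟨ cong (λ m → i′ + m) x∸i′≡j′N ⟨
        i′ + (x ∸ i′)     ≡⟨ m+[n∸m]≡n (≤-pred i′≤x) ⟩
        x                 ∎))

  partialProd-vanishes : ∀ T y → d ^ T ≤ y → pp T y ≡ + 0
  partialProd-vanishes zero    (suc y) _ = refl
  partialProd-vanishes (suc T) y N≤y with splitAt T y
  ... | split i j i<N = begin
    pp (suc T) (i + j * d ^ T)   ≡⟨ partialProd-step T (partialProd-vanishes T) j i<N ⟩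
    pp T i ℤ.* coefP d u j       ≡⟨ cong (pp T i ℤ.*_) (coefP-≥ d≤j) ⟩
    pp T i ℤ.* + 0               ≡⟨ ℤ.*-zeroʳ (pp T i) ⟩
    + 0                          ∎
    where
    open ≡-Reasoning
    d≤j : d ≤ j
    d≤j = ≤-pred (*-cancelʳ-< (d ^ T) d (suc j) (≤-<-trans N≤y (+-monoˡ-< (j * d ^ T) i<N)))

  partialProd-digit : ∀ T {i} j → i < d ^ T → pp (suc T) (i + j * d ^ T) ≡ pp T i ℤ.* coefP d u j
  partialProd-digit T = partialProd-step T (partialProd-vanishes T)

  partialProd-zero : ∀ T → pp T 0 ≡ + 1
  partialProd-zero zero    = refl
  partialProd-zero (suc T) = begin
    pp (suc T) 0            ≡⟨ partialProd-digit T 0 (m^n>0 d T) ⟩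
    pp T 0 ℤ.* + 1          ≡⟨ ℤ.*-identityʳ (pp T 0) ⟩
    pp T 0                  ≡⟨ partialProd-zero T ⟩
    + 1                     ∎
    where open ≡-Reasoning

  -- A nonzero digit j in place T costs one factor b and forces x ≥ d ^ T, i.e. T < k.
  ∣partialProd∣≤ : ∀ T {x} k → 1 ≤ x → x < d ^ k → ∣ pp T x ∣ ≤ b ^ k
  ∣partialProd∣≤ zero    {suc x} _ _ _ = z≤n
  ∣partialProd∣≤ (suc T) {x} k 1≤x x<dᵏ with splitAt T x
  ... | split i zero i<N = begin
    ∣ pp (suc T) (i + 0) ∣   ≡⟨ cong ∣_∣ (partialProd-digit T 0 i<N) ⟩
    ∣ pp T i ℤ.* + 1 ∣       ≡⟨ cong ∣_∣ (ℤ.*-identityʳ (pp T i)) ⟩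
    ∣ pp T i ∣               ≤⟨ ∣partialProd∣≤ T k (subst (1 ≤_) i+0≡i 1≤x) (subst (_< d ^ k) i+0≡i x<dᵏ) ⟩
    b ^ k                    ∎
    where
    open ≤-Reasoning
    i+0≡i : i + 0 ≡ i
    i+0≡i = +-identityʳ i
  ... | split i (suc j) i<N = begin
    ∣ pp (suc T) (i + suc j * d ^ T) ∣  ≡⟨ cong ∣_∣ (partialProd-digit T (suc j) i<N) ⟩
    ∣ pp T i ℤ.* coefP d u (suc j) ∣    ≡⟨ ℤ.∣i*j∣≡∣i∣*∣j∣ (pp T i) (coefP d u (suc j)) ⟩
    ∣ pp T i ∣ * ∣ coefP d u (suc j) ∣  ≤⟨ *-monoʳ-≤ ∣ pp T i ∣ (∣coefP∣≤supNorm j) ⟩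
    ∣ pp T i ∣ * b                      ≤⟨ ∣pp∣*b≤ i i<N ⟩
    b ^ suc T                           ≤⟨ ^-monoʳ-≤′ b (s≤s z≤n) T<k ⟩
    b ^ k                               ∎
    where
    open ≤-Reasoning
    T<k : T < k
    T<k = ^-cancelˡ-< d (≤-<-trans (≤-trans (m≤m+n (d ^ T) (j * d ^ T)) (m≤n+m _ i)) x<dᵏ)
    ∣pp∣*b≤ : ∀ i → i < d ^ T → ∣ pp T i ∣ * b ≤ b ^ suc T
    ∣pp∣*b≤ zero    _   rewrite partialProd-zero T | +-identityʳ b =
      subst (_≤ b ^ suc T) (*-identityʳ b) (^-monoʳ-≤′ b {1} {suc T} ≤-refl (s≤s z≤n))
    ∣pp∣*b≤ (suc i) i<N = subst (∣ pp T (suc i) ∣ * b ≤_) (*-comm (b ^ T) b)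
                            (*-monoˡ-≤ b (∣partialProd∣≤ T T (s≤s z≤n) i<N))

  ∣c∣≤ : 1 ≤ b → ∀ {n} k → 1 ≤ n → n ≤ d ^ k → ∣ c d u n ∣ ≤ b ^ k
  ∣c∣≤ 1≤b {suc zero}    k _ _ rewrite partialProd-zero 1 = m^n>0 b k
    where instance _ = >-nonZero 1≤b
  ∣c∣≤ 1≤b {suc (suc m)} k _ n≤dᵏ = ∣partialProd∣≤ (suc (suc m)) k (s≤s z≤n) n≤dᵏ

  fCoeff-vanishes : 1 < d → b ≡ 0 → ∀ m → fCoeff d u (suc m) ≡ + 0
  fCoeff-vanishes 1<d b≡0 m = ℤ.∣i∣≡0⇒i≡0 (n≤0⇒n≡0 (subst (λ β → ∣ fCoeff d u (suc m) ∣ ≤ β ^ suc m) b≡0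
    (∣partialProd∣≤ (suc (suc m)) (suc m) (s≤s z≤n) (n<m^n d 1<d (suc m)))))

  f-isPoly : 1 < d → b ≡ 0 → IsPoly (fL d u)
  f-isPoly 1<d b≡0 m rewrite fCoeff-vanishes 1<d b≡0 m = refl

sumℚ-zero : ∀ n h → (∀ i → h i ≡ 0ℚ) → sumℚ n h ≡ 0ℚ
sumℚ-zero zero    h h≡0 = refl
sumℚ-zero (suc n) h h≡0 rewrite sumℚ-zero n h h≡0 | h≡0 n = refl

coeff-above : ∀ L k → top L < k → coeff L (+ k) ≡ 0ℚ
coeff-above L k top<k with k ≤? top L
... | yes k≤top = ⊥-elim (<⇒≱ top<k k≤top)
... | no  _     = refl

coeff-fromCoeff : ∀ T h k → k ≤ T → coeff (fromCoeff T h) (+ k) ≡ h (+ k)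
coeff-fromCoeff T h k k≤T with k ≤? T
... | yes _   = cong h (trans (ℤ.m-n≡m⊖n T (T ∸ k)) (trans (ℤ.⊖-≥ (m∸n≤m T k)) (cong +_ (m∸[m∸n]≡n k≤T))))
... | no  k≰T = ⊥-elim (k≰T k≤T)

coeff-vanishes : ∀ L → (∀ i → co L i ≡ 0ℚ) → ∀ k → coeff L k ≡ 0ℚ
coeff-vanishes L co≡0 (+ k) with k ≤? top L
... | yes _ = co≡0 (top L ∸ k)
... | no  _ = refl
coeff-vanishes L co≡0 -[1+ k ] = co≡0 (top L + suc k)

*L-vanishesʳ : ∀ A B → (∀ i → co B i ≡ 0ℚ) → ∀ i → co (A *L B) i ≡ 0ℚ
*L-vanishesʳ A B co≡0 m =
  sumℚ-zero (suc m) _ (λ i → trans (cong (co A i ℚ.*_) (co≡0 (m ∸ i))) (ℚ.*-zeroʳ (co A i)))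

-- A polynomial is its own first partial quotient, so the first remainder F 0 -L a 0
-- is 0 and cannot be inverted.
polynomial-remainder-vanishes : ∀ {f a F} → IsPoly f → IsCF f a F → ∀ i → co (F 0 -L a 0) i ≡ 0ℚ
polynomial-remainder-vanishes {f} {a} {F} f-poly (F₀≈f , a-poly , frac , _) i = diff≡0 (+ T ℤ.- + i)
  where
  T : ℕ
  T = top (F 0) ⊔ top (a 0)
  diff≡0 : ∀ k → coeff (F 0) k ℚ.- coeff (a 0) k ≡ 0ℚ
  diff≡0 -[1+ k ] rewrite F₀≈f -[1+ k ] | f-poly k | a-poly 0 k = refl
  diff≡0 (+ k) with k ≤? T
  ... | yes k≤T = trans (sym (coeff-fromCoeff T (λ k → coeff (F 0) k ℚ.- coeff (a 0) k) k k≤T)) (frac 0 k)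
  ... | no  k≰T rewrite coeff-above (F 0) k (≤-<-trans (m≤m⊔n _ _) (≰⇒> k≰T))
                      | coeff-above (a 0) k (≤-<-trans (m≤n⊔m _ _) (≰⇒> k≰T)) = refl

polynomial-¬badlyApproximable : ∀ {f} → IsPoly f → ¬ BadlyApproximable f
polynomial-¬badlyApproximable f-poly (a , F , cf@(_ , _ , _ , inverse) , _) =
  ℚ.1≢0 (trans (sym (inverse 0 (+ 0))) (coeff-vanishes (F 1 *L F₀-a₀) product≡0 (+ 0)))
  where
  F₀-a₀ : Laurent
  F₀-a₀ = F 0 -L a 0
  product≡0 : ∀ i → co (F 1 *L F₀-a₀) i ≡ 0ℚ
  product≡0 = *L-vanishesʳ (F 1) F₀-a₀ (polynomial-remainder-vanishes f-poly cf)

IsCeilLog : ℕ → ℕ → ℕ → Set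
IsCeilLog d n r = n ≤ d ^ r × (∀ j → j < r → d ^ j < n)

module LinearSearch (d n : ℕ) (step : ℕ → (k : ℕ) → Dec (n ≤ d ^ k) → ℕ)
  (step-yes : ∀ f k p → step f k (yes p) ≡ k)
  (step-no-zero : ∀ k p → step zero k (no p) ≡ suc k)
  (step-no-suc : ∀ f k p → step (suc f) k (no p) ≡ step f (suc k) (n ≤? d ^ suc k)) where

  below-suc : ∀ {k} → (∀ j → j < k → d ^ j < n) → ¬ n ≤ d ^ k → ∀ j → j < suc k → d ^ j < n
  below-suc below n≰dᵏ j j<1+k with m<1+n⇒m<n∨m≡n j<1+k
  ... | inj₁ j<k  = below j j<k
  ... | inj₂ refl = ≰⇒> n≰dᵏ

  step-isCeilLog : ∀ f k D → (∀ j → j < k → d ^ j < n) → n ≤ d ^ (suc f + k) → IsCeilLog d n (step f k D)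
  step-isCeilLog f       k (yes p) below _ rewrite step-yes f k p = p , below
  step-isCeilLog zero    k (no p) below bound rewrite step-no-zero k p = bound , below-suc below p
  step-isCeilLog (suc f) k (no p) below bound rewrite step-no-suc f k p =
    step-isCeilLog f (suc k) _ (below-suc below p) (subst (λ e → n ≤ d ^ e) (sym (+-suc (suc f) k)) bound)

-- ceilLog runs a loop local to Defs. Its with-function is recovered as ceilLogStep by
-- unification in ceilLog-isCeilLog, once n and the exponent are generalised to variables.
mutual
  ceilLogStep : (d n : ℕ) → ℕ → (k : ℕ) → Dec (n ≤ d ^ k) → ℕ
  ceilLogStep d n = _

  ceilLog-isCeilLog : ∀ d n → 1 < d → 1 ≤ n → IsCeilLog d n (ceilLog d n)
  ceilLog-isCeilLog d (suc m) 1<d _ with suc m ≤? d ^ 0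
  ... | yes p = p , λ _ ()
  ... | no p with suc m in m+1≡n | 1 in 1≡K
  ceilLog-isCeilLog d (suc zero)    1<d _ | no p | n | K = ⊥-elim (p (subst₂ _≤_ m+1≡n 1≡K ≤-refl))
  ceilLog-isCeilLog d (suc (suc m)) 1<d _ | no p | n | K with n ≤? d ^ K
  ... | D = LinearSearch.step-isCeilLog d n (ceilLogStep d n) (λ _ _ _ → refl) (λ _ _ → refl) (λ _ _ _ → refl)
              m K D below bound
    where
    below : ∀ j → j < K → d ^ j < n
    below j j<K rewrite sym 1≡K | sym m+1≡n with j<K
    ... | s≤s z≤n = s≤s (s≤s z≤n)
    bound : n ≤ d ^ (suc m + K)
    bound rewrite sym 1≡K | sym m+1≡n | +-comm m 1 = <⇒≤ (n<m^n d 1<d (suc (suc m)))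

LeRPow-mono : ∀ {a a′ b d n} → a ≤ a′ → LeRPow a′ b d n → LeRPow a b d n
LeRPow-mono a≤a′ le p q 1≤q nᵠ<dᵖ = ≤-trans (^-monoˡ-≤ q a≤a′) (le p q 1≤q nᵠ<dᵖ)

-- n ^ q < d ^ p together with d ^ (r - 1) < n gives (r - 1) q < p, i.e. r q ≤ p + q.
LeRPow-pow : ∀ {b d n} r .{{_ : NonZero d}} → 1 ≤ b → (∀ j → j < r → d ^ j < n) → LeRPow (b ^ r) b d n
LeRPow-pow {b} zero 1≤b _ p q _ _ = subst (_≤ b ^ (p + q)) (sym (^-zeroˡ q)) (m^n>0 b (p + q))
  where instance _ = >-nonZero 1≤b
LeRPow-pow {b} {d} {n} (suc r) 1≤b below p q _ nᵠ<dᵖ = begin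
  (b ^ suc r) ^ q  ≡⟨ ^-*-assoc b (suc r) q ⟩
  b ^ (q + r * q)  ≤⟨ ^-monoʳ-≤ b (+-monoʳ-≤ q (<⇒≤ rq<p)) ⟩
  b ^ (q + p)      ≡⟨ cong (b ^_) (+-comm q p) ⟩
  b ^ (p + q)      ∎
  where
  open ≤-Reasoning
  instance _ = >-nonZero 1≤b
  rq<p : r * q < p
  rq<p = ^-cancelˡ-< d (begin-strict
    d ^ (r * q)  ≡⟨ ^-*-assoc d r q ⟨
    (d ^ r) ^ q  ≤⟨ ^-monoˡ-≤ q (<⇒≤ (below r ≤-refl)) ⟩
    n ^ q        <⟨ nᵠ<dᵖ ⟩
    d ^ p        ∎)

cNorm-≤ : ∀ d u n {B} → (∀ i → 1 ≤ i → i ≤ n → ∣ c d u i ∣ ≤ B) → cNorm d u n ≤ B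
cNorm-≤ d u zero    _   = z≤n
cNorm-≤ d u (suc n) c≤B =
  ⊔-lub (cNorm-≤ d u n (λ i 1≤i i≤n → c≤B i 1≤i (m≤n⇒m≤1+n i≤n))) (c≤B (suc n) (s≤s z≤n) ≤-refl)

lemma1 : (d : ℕ) → 2 ≤ d → (u : Fin (d ∸ 1) → ℤ) → PAtOne d u →
         BadlyApproximable (fL d u) →
         (n : ℕ) → 1 ≤ n →
         (∣ c d u n ∣ ≤ supNorm (d ∸ 1) u ^ ceilLog d n)
         × LeRPow (supNorm (d ∸ 1) u ^ ceilLog d n) (supNorm (d ∸ 1) u) d n
         × LeRPow (cNorm d u n) (supNorm (d ∸ 1) u) d n
lemma1 d@(suc (suc e)) 1<d@(s≤s (s≤s z≤n)) u _ badly n 1≤n =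
  ∣c∣≤ 1≤b r 1≤n n≤dʳ , LeRPow-pow r 1≤b below , LeRPow-mono cNorm≤bʳ (LeRPow-pow r 1≤b below)
  where
  open PartialProducts (suc e) u using (b; ∣c∣≤; f-isPoly)
  r : ℕ
  r = ceilLog d n
  n≤dʳ : n ≤ d ^ r
  n≤dʳ = proj₁ (ceilLog-isCeilLog d n 1<d 1≤n)
  below : ∀ j → j < r → d ^ j < n
  below = proj₂ (ceilLog-isCeilLog d n 1<d 1≤n)
  1≤b : 1 ≤ b
  1≤b = n≢0⇒n>0 (λ b≡0 → polynomial-¬badlyApproximable (f-isPoly 1<d b≡0) badly)
  cNorm≤bʳ : cNorm d u n ≤ b ^ r
  cNorm≤bʳ = cNorm-≤ d u n (λ i 1≤i i≤n → ∣c∣≤ 1≤b r 1≤i (≤-trans i≤n n≤dʳ))
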